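{- Let $A\subseteq2^\omega$ be a set of proper sequences such that $s_\alpha\equiv_{sW}s_\beta$ for all $\alpha,\beta\in A$, and let $F$ be any $n$-dimensional truth-table. Then for any $\alpha_1,\dots,\alpha_n\in A$ and any $\beta_1,\dots,\beta_n\in A$ we have $s^F_{\alpha_1,\dots,\alpha_n}\equiv_{sW}s^F_{\beta_1,\dots,\beta_n}$.
   Context: Cantor space $2^\omega$ carries the lexicographic order $<_{lex}$. For $\alpha\in2^\omega$, $s_\alpha(x)=0$ if $x<_{lex}\alpha$ and $1$ otherwise. A sequence is proper if it contains infinitely many $1$'s. For $F\colon\{0,1\}^n\to\{0,1\}$ and proper $\alpha_1,\dots,\alpha_n$, $s^F_{\alpha_1,\dots,\alpha_n}(x_1,\dots,x_n)=F(s_{\alpha_1}(x_1),\dots,s_{\alpha_n}(x_n))$. $f\le_{sW}g$ means there are computable functionals $\Phi,\Psi$ with $f(x)=\Psi(g(\Phi(x)))$ for all $x$; $\equiv_{sW}$ means both directions. -}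

module Defs where

open import Data.Nat using (ℕ; zero; suc; _≤_)
open import Data.Fin using (Fin; toℕ) renaming (zero to fzero; suc to fsuc)
open import Data.Vec using (Vec; []; _∷_; lookup)
open import Data.Bool using (Bool; true; false; if_then_else_)
open import Data.Maybe using (Maybe; just; nothing; _>>=_)
open import Data.Product using (Σ; ∃; _×_; _,_)
open import Data.Sum using (_⊎_)
open import Relation.Nullary using (¬_)
open import Relation.Binary.PropositionalEquality using (_≡_)

Cantor : Set
Cantor = ℕ → Bool

_<lex_ : Cantor → Cantor → Set
x <lex α = ∃ λ n → (∀ m → Data.Nat._<_ m n → x m ≡ α m) × (x n ≡ false) × (α n ≡ true)

Proper : Cantor → Set
Proper α = ∀ m → ∃ λ k → (m ≤ k) × (α k ≡ true)

-- Bool-valued functions on tuples of Cantor-space points are given by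
-- their graphs (the lexicographic comparison is not constructively
-- decidable, so s_α cannot be an Agda function Cantor → Bool).

Graph : ℕ → Set₁
Graph n = (Fin n → Cantor) → Bool → Set

S : Cantor → Cantor → Bool → Set
S α x b = ((b ≡ false) × (x <lex α)) ⊎ ((b ≡ true) × ¬ (x <lex α))

s₁ : Cantor → Graph 1
s₁ α x b = S α (x fzero) b

sF : ∀ {n} → ((Fin n → Bool) → Bool) → (Fin n → Cantor) → Graph n
sF {n} F α x b = Σ (Fin n → Bool) λ bs → (∀ i → S (α i) (x i) (bs i)) × (F bs ≡ b)

-- Oracle partial recursive functions (codes), with a fuel-bounded
-- evaluator.  The oracle is a function ℕ → ℕ → ℕ queried at (i , j).

data Code : ℕ → Set where
  zeroC : ∀ {k} → Code k
  succC : Code 1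
  projC : ∀ {k} → Fin k → Code k
  compC : ∀ {k m} → Code m → Vec (Code k) m → Code k
  precC : ∀ {k} → Code k → Code (suc (suc k)) → Code (suc k)
  muC   : ∀ {k} → Code (suc k) → Code k
  oraC  : Code 2

Oracle : Set
Oracle = ℕ → ℕ → ℕ

mutual
  eval : ∀ {k} → ℕ → Oracle → Code k → Vec ℕ k → Maybe ℕ
  eval fu o zeroC xs = just 0
  eval fu o succC (x ∷ []) = just (suc x)
  eval fu o (projC i) xs = just (lookup xs i)
  eval fu o (compC f gs) xs = evalVec fu o gs xs >>= λ ys → eval fu o f ys
  eval fu o (precC g h) (y ∷ xs) = precLoop fu o g h y xs
  eval fu o (muC f) xs = search fu o f fu 0 xs
  eval fu o oraC (i ∷ j ∷ []) = just (o i j)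

  evalVec : ∀ {k m} → ℕ → Oracle → Vec (Code k) m → Vec ℕ k → Maybe (Vec ℕ m)
  evalVec fu o [] xs = just []
  evalVec fu o (g ∷ gs) xs =
    eval fu o g xs >>= λ y → evalVec fu o gs xs >>= λ ys → just (y ∷ ys)

  precLoop : ∀ {k} → ℕ → Oracle → Code k → Code (suc (suc k)) → ℕ → Vec ℕ k → Maybe ℕ
  precLoop fu o g h zero xs = eval fu o g xs
  precLoop fu o g h (suc y) xs =
    precLoop fu o g h y xs >>= λ r → eval fu o h (y ∷ r ∷ xs)

  search : ∀ {k} → ℕ → Oracle → Code (suc k) → ℕ → ℕ → Vec ℕ k → Maybe ℕ
  search fu o f zero i xs = nothing
  search fu o f (suc b) i xs = eval fu o f (i ∷ xs) >>= λ
    { zero → just i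
    ; (suc _) → search fu o f b (suc i) xs }

bit : Bool → ℕ
bit b = if b then 1 else 0

-- a tuple of m sequences as an oracle: (i , j) ↦ x_i(j)  (0 if i ≥ m)
tupleAt : ∀ {m} → (Fin m → Cantor) → ℕ → ℕ → Bool
tupleAt {zero} x i j = false
tupleAt {suc m} x zero j = x fzero j
tupleAt {suc m} x (suc i) j = tupleAt (λ a → x (fsuc a)) i j

-- Φ : (2^ω)^m → (2^ω)^k is a computable functional: there is an oracle
-- program computing Φ(x)_i(j) from (i , j) relative to x.
Computable : ∀ {m k} → ((Fin m → Cantor) → (Fin k → Cantor)) → Set
Computable {m} {k} Φ =
  Σ (Code 2) λ e → ∀ (x : Fin m → Cantor) (i : Fin k) (j : ℕ) →
    ∃ λ fu → eval fu (λ a b → bit (tupleAt x a b)) e (toℕ i ∷ j ∷ []) ≡ just (bit (Φ x i j))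

-- strong Weihrauch reducibility f ≤sW g for {0,1}-valued functions
-- (given by their graphs); Ψ : {0,1} → {0,1} is automatically computable.
_≤sW_ : ∀ {m k} → Graph m → Graph k → Set
_≤sW_ {m} {k} f g =
  Σ ((Fin m → Cantor) → (Fin k → Cantor)) λ Φ → Computable Φ ×
    Σ (Bool → Bool) λ Ψ → ∀ x b → g (Φ x) b → f x (Ψ b)

_≡sW_ : ∀ {m k} → Graph m → Graph k → Set
f ≡sW g = (f ≤sW g) × (g ≤sW f)

{-# OPTIONS --safe #-}
module Submission where

-- For proper α, every strong Weihrauch reduction of s_α to s_β has the identity as its
-- backward map Ψ.  Indeed s_α(α) = 1, and properness gives points x <lex α arbitrarily
-- close to α, where s_α(x) = 0; so Ψ is onto, hence the identity or negation.  Were it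
-- negation, Φ(α) <lex β would hold; this is witnessed by a finite prefix, so by
-- continuity of Φ also Φ(x) <lex β for such x close to α, forcing s_α(x) = Ψ(0) = 1.
-- Reductions with Ψ = id can be run coordinatewise in parallel, and F then commutes
-- with them, so s_{α_i} ≤sW s_{β_i} for all i gives s^F_α ≤sW s^F_β.

open import Defs
open import Data.Nat using (ℕ; zero; suc; _≤_; _<_; _⊔_; s≤s)
open import Data.Nat.Properties
  using (<-≤-trans; m≤m⊔n; m≤n⊔m; n<1+n; m<n⇒m<1+n; m<1+n⇒m<n∨m≡n)
open import Data.Fin using (Fin; toℕ) renaming (zero to fzero; suc to fsuc)
open import Data.Vec using (Vec; []; _∷_)
open import Data.Bool using (Bool; true; false)
open import Data.Bool.Properties using (¬-not; not-¬)
open import Data.Maybe using (Maybe; just; nothing; _>>=_)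
open import Data.Maybe.Properties using (just-injective)
open import Data.Product using (∃; _×_; _,_; proj₁; proj₂)
open import Data.Sum using (_⊎_; inj₁; inj₂)
open import Data.Empty using (⊥-elim)
open import Function using (_∘_)
open import Relation.Nullary using (¬_)
open import Relation.Binary.PropositionalEquality using (_≡_; _≢_; refl; sym; trans; cong; subst)

_≈[_]_ : {A : Set} → (ℕ → A) → ℕ → (ℕ → A) → Set
u ≈[ N ] v = ∀ m → m < N → u m ≡ v m

≈-weaken : ∀ {A : Set} {u v : ℕ → A} {N N′} → N ≤ N′ → u ≈[ N′ ] v → u ≈[ N ] v
≈-weaken N≤N′ u≈v m m<N = u≈v m (<-≤-trans m<N N≤N′)

>>=-just⁻ : ∀ {A B : Set} (m : Maybe A) {k : A → Maybe B} {r} →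
  (m >>= k) ≡ just r → ∃ λ y → m ≡ just y × k y ≡ just r
>>=-just⁻ (just y) eq = y , refl , eq

>>=-just⁺ : ∀ {A B : Set} {m : Maybe A} {y} (k : A → Maybe B) {r} →
  m ≡ just y → k y ≡ just r → (m >>= k) ≡ just r
>>=-just⁺ k refl eq = eq

>>=-cong : ∀ {A B : Set} {m m′ : Maybe A} {k k′ : A → Maybe B} →
  m ≡ m′ → (∀ y → k y ≡ k′ y) → (m >>= k) ≡ (m′ >>= k′)
>>=-cong {m = nothing} refl _ = refl
>>=-cong {m = just y}  refl k≗k′ = k≗k′ y

bit-injective : ∀ {a b} → bit a ≡ bit b → a ≡ b
bit-injective {false} {false} _ = refl
bit-injective {true}  {true}  _ = refl

Stable : {A : Set} → (ℕ → Oracle → Maybe A) → ℕ → Oracle → A → Set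
Stable c fu o r = ∃ λ N → ∀ fu′ o′ → fu ≤ fu′ → (∀ a → o a ≈[ N ] o′ a) → c fu′ o′ ≡ just r

>>=-stable : ∀ {A B : Set} {c : ℕ → Oracle → Maybe A} {d : A → ℕ → Oracle → Maybe B}
  {fu o y r} → Stable c fu o y → Stable (d y) fu o r →
  Stable (λ fu o → c fu o >>= λ z → d z fu o) fu o r
>>=-stable {d = d} (N₁ , c-stable) (N₂ , d-stable) = N₁ ⊔ N₂ , λ fu′ o′ le o≈o′ →
  >>=-just⁺ (λ z → d z fu′ o′)
    (c-stable fu′ o′ le (λ a → ≈-weaken (m≤m⊔n N₁ N₂) (o≈o′ a)))
    (d-stable fu′ o′ le (λ a → ≈-weaken (m≤n⊔m N₁ N₂) (o≈o′ a)))

mutual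
  eval-stable : ∀ {k} fu o (e : Code k) v {r} → eval fu o e v ≡ just r →
    Stable (λ fu o → eval fu o e v) fu o r
  eval-stable fu o zeroC v eq = 0 , λ _ _ _ _ → eq
  eval-stable fu o succC (x ∷ []) eq = 0 , λ _ _ _ _ → eq
  eval-stable fu o (projC i) v eq = 0 , λ _ _ _ _ → eq
  eval-stable fu o (compC f gs) v eq with >>=-just⁻ (evalVec fu o gs v) eq
  ... | ys , gs⇓ , f⇓ = >>=-stable (evalVec-stable fu o gs v gs⇓) (eval-stable fu o f ys f⇓)
  eval-stable fu o (precC g h) (y ∷ xs) eq = precLoop-stable fu o g h y xs eq
  eval-stable fu o (muC f) xs eq with search-stable fu o f fu 0 xs eq
  ... | N , stable = N , λ fu′ o′ le o≈o′ → stable fu′ fu′ o′ le le o≈o′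
  eval-stable fu o oraC (i ∷ j ∷ []) eq =
    suc j , λ _ _ _ o≈o′ → trans (cong just (sym (o≈o′ i j (n<1+n j)))) eq

  evalVec-stable : ∀ {k m} fu o (gs : Vec (Code k) m) xs {r} → evalVec fu o gs xs ≡ just r →
    Stable (λ fu o → evalVec fu o gs xs) fu o r
  evalVec-stable fu o [] xs eq = 0 , λ _ _ _ _ → eq
  evalVec-stable fu o (g ∷ gs) xs eq with >>=-just⁻ (eval fu o g xs) eq
  ... | y , g⇓ , rest⇓ with >>=-just⁻ (evalVec fu o gs xs) rest⇓
  ... | ys , gs⇓ , refl =
    >>=-stable (eval-stable fu o g xs g⇓)
      (>>=-stable {d = λ ys _ _ → just (y ∷ ys)} (evalVec-stable fu o gs xs gs⇓) (0 , λ _ _ _ _ → refl))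

  precLoop-stable : ∀ {k} fu o (g : Code k) h y xs {r} → precLoop fu o g h y xs ≡ just r →
    Stable (λ fu o → precLoop fu o g h y xs) fu o r
  precLoop-stable fu o g h zero xs eq = eval-stable fu o g xs eq
  precLoop-stable fu o g h (suc y) xs eq with >>=-just⁻ (precLoop fu o g h y xs) eq
  ... | r , loop⇓ , h⇓ =
    >>=-stable (precLoop-stable fu o g h y xs loop⇓) (eval-stable fu o h (y ∷ r ∷ xs) h⇓)

  search-stable : ∀ {k} fu o (f : Code (suc k)) b i xs {r} → search fu o f b i xs ≡ just r →
    ∃ λ N → ∀ fu′ b′ o′ → fu ≤ fu′ → b ≤ b′ → (∀ a → o a ≈[ N ] o′ a) →
      search fu′ o′ f b′ i xs ≡ just r
  search-stable fu o f (suc b) i xs eq with >>=-just⁻ (eval fu o f (i ∷ xs)) eq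
  ... | zero , f⇓ , found with eval-stable fu o f (i ∷ xs) f⇓
  ... | N , stable = N , λ { fu′ (suc b′) o′ le _ o≈o′ →
    >>=-just⁺ _ (stable fu′ o′ le o≈o′) found }
  search-stable fu o f (suc b) i xs eq | suc _ , f⇓ , next
    with eval-stable fu o f (i ∷ xs) f⇓ | search-stable fu o f b (suc i) xs next
  ... | N₁ , f-stable | N₂ , next-stable = N₁ ⊔ N₂ , λ { fu′ (suc b′) o′ le (s≤s b≤b′) o≈o′ →
    >>=-just⁺ _ (f-stable fu′ o′ le (λ a → ≈-weaken (m≤m⊔n N₁ N₂) (o≈o′ a)))
      (next-stable fu′ b′ o′ le b≤b′ (λ a → ≈-weaken (m≤n⊔m N₁ N₂) (o≈o′ a))) }

eval-mono : ∀ {k fu fu′ o r} (e : Code k) v → fu ≤ fu′ →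
  eval fu o e v ≡ just r → eval fu′ o e v ≡ just r
eval-mono {fu = fu} {o = o} e v le eq with eval-stable fu o e v eq
... | _ , stable = stable _ o le (λ _ _ _ → refl)

_⊢_∙_⇓_ : ∀ {k} → Oracle → Code k → Vec ℕ k → ℕ → Set
o ⊢ e ∙ v ⇓ r = ∃ λ fu → eval fu o e v ≡ just r

oracle : ∀ {m} → (Fin m → Cantor) → Oracle
oracle x a j = bit (tupleAt x a j)

tupleAt-toℕ : ∀ {m} (x : Fin m → Cantor) (t : Fin m) j → tupleAt x (toℕ t) j ≡ x t j
tupleAt-toℕ x fzero    j = refl
tupleAt-toℕ x (fsuc t) j = tupleAt-toℕ (x ∘ fsuc) t j

tupleAt-≈ : ∀ {m N} {x y : Fin m → Cantor} → (∀ t → x t ≈[ N ] y t) →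
  ∀ a → tupleAt x a ≈[ N ] tupleAt y a
tupleAt-≈ {zero}  x≈y a       j j<N = refl
tupleAt-≈ {suc m} x≈y zero    j j<N = x≈y fzero j j<N
tupleAt-≈ {suc m} x≈y (suc a) j j<N = tupleAt-≈ (x≈y ∘ fsuc) a j j<N

computable-continuous : ∀ {m k} {Φ : (Fin m → Cantor) → (Fin k → Cantor)} → Computable Φ →
  ∀ x i j → ∃ λ N → ∀ y → (∀ t → x t ≈[ N ] y t) → Φ x i j ≡ Φ y i j
computable-continuous {Φ = Φ} (e , e-computes) x i j with e-computes x i j
... | fu , x⇓ with eval-stable fu (oracle x) e (toℕ i ∷ j ∷ []) x⇓
... | N , stable = N , λ y x≈y → Φx≡Φy y x≈y (e-computes y i j)
  where
  Φx≡Φy : ∀ y → (∀ t → x t ≈[ N ] y t) → oracle y ⊢ e ∙ (toℕ i ∷ j ∷ []) ⇓ bit (Φ y i j) →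
    Φ x i j ≡ Φ y i j
  Φx≡Φy y x≈y (fu′ , y⇓) = bit-injective (just-injective (trans
    (sym (stable (fu ⊔ fu′) (oracle y) (m≤m⊔n fu fu′) λ a j j<N → cong bit (tupleAt-≈ x≈y a j j<N)))
    (eval-mono e (toℕ i ∷ j ∷ []) (m≤n⊔m fu fu′) y⇓)))

computable-uniformly-continuous : ∀ {m k} {Φ : (Fin m → Cantor) → (Fin k → Cantor)} →
  Computable Φ → ∀ x i n → ∃ λ N → ∀ y → (∀ t → x t ≈[ N ] y t) → Φ x i ≈[ n ] Φ y i
computable-uniformly-continuous cΦ x i zero = 0 , λ _ _ _ ()
computable-uniformly-continuous {Φ = Φ} cΦ x i (suc n)
  with computable-uniformly-continuous cΦ x i n | computable-continuous cΦ x i n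
... | N₁ , below-n | N₂ , at-n = N₁ ⊔ N₂ , λ y x≈y j j<1+n → agree y x≈y j (m<1+n⇒m<n∨m≡n j<1+n)
  where
  agree : ∀ y → (∀ t → x t ≈[ N₁ ⊔ N₂ ] y t) → ∀ j → j < n ⊎ j ≡ n → Φ x i j ≡ Φ y i j
  agree y x≈y j (inj₁ j<n) = below-n y (λ t → ≈-weaken (m≤m⊔n N₁ N₂) (x≈y t)) j j<n
  agree y x≈y j (inj₂ refl) = at-n y (λ t → ≈-weaken (m≤n⊔m N₁ N₂) (x≈y t))

mutual
  replaceOracle : ∀ {k} → Code 2 → Code k → Code k
  replaceOracle c zeroC        = zeroC
  replaceOracle c succC        = succC
  replaceOracle c (projC i)    = projC i
  replaceOracle c (compC f gs) = compC (replaceOracle c f) (replaceOracleVec c gs)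
  replaceOracle c (precC g h)  = precC (replaceOracle c g) (replaceOracle c h)
  replaceOracle c (muC f)      = muC (replaceOracle c f)
  replaceOracle c oraC         = c

  replaceOracleVec : ∀ {k m} → Code 2 → Vec (Code k) m → Vec (Code k) m
  replaceOracleVec c []       = []
  replaceOracleVec c (g ∷ gs) = replaceOracle c g ∷ replaceOracleVec c gs

module _ {o o′ : Oracle} (c : Code 2) (c-computes : ∀ fu a j → eval fu o c (a ∷ j ∷ []) ≡ just (o′ a j)) where
  mutual
    eval-replaceOracle : ∀ {k} fu (e : Code k) v → eval fu o (replaceOracle c e) v ≡ eval fu o′ e v
    eval-replaceOracle fu zeroC v = refl
    eval-replaceOracle fu succC (x ∷ []) = refl
    eval-replaceOracle fu (projC i) v = refl
    eval-replaceOracle fu (compC f gs) v =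
      >>=-cong (evalVec-replaceOracle fu gs v) (eval-replaceOracle fu f)
    eval-replaceOracle fu (precC g h) (y ∷ xs) = precLoop-replaceOracle fu g h y xs
    eval-replaceOracle fu (muC f) xs = search-replaceOracle fu f fu 0 xs
    eval-replaceOracle fu oraC (a ∷ j ∷ []) = c-computes fu a j

    evalVec-replaceOracle : ∀ {k m} fu (gs : Vec (Code k) m) v →
      evalVec fu o (replaceOracleVec c gs) v ≡ evalVec fu o′ gs v
    evalVec-replaceOracle fu [] v = refl
    evalVec-replaceOracle fu (g ∷ gs) v =
      >>=-cong (eval-replaceOracle fu g v) λ _ → >>=-cong (evalVec-replaceOracle fu gs v) λ _ → refl

    precLoop-replaceOracle : ∀ {k} fu (g : Code k) h y xs →
      precLoop fu o (replaceOracle c g) (replaceOracle c h) y xs ≡ precLoop fu o′ g h y xs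
    precLoop-replaceOracle fu g h zero xs = eval-replaceOracle fu g xs
    precLoop-replaceOracle fu g h (suc y) xs =
      >>=-cong (precLoop-replaceOracle fu g h y xs) λ r → eval-replaceOracle fu h (y ∷ r ∷ xs)

    search-replaceOracle : ∀ {k} fu (f : Code (suc k)) b i xs →
      search fu o (replaceOracle c f) b i xs ≡ search fu o′ f b i xs
    search-replaceOracle fu f zero i xs = refl
    search-replaceOracle fu f (suc b) i xs = >>=-cong (eval-replaceOracle fu f (i ∷ xs)) λ
      { zero → refl ; (suc _) → search-replaceOracle fu f b (suc i) xs }

numeral : ℕ → Code 1
numeral zero    = zeroC
numeral (suc n) = compC succC (numeral n ∷ [])

eval-numeral : ∀ fu o n v → eval fu o (numeral n) v ≡ just n
eval-numeral fu o zero    v = refl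
eval-numeral fu o (suc n) v rewrite eval-numeral fu o n v = refl

-- Oracle code of the single row t: (a , j) ↦ o (t , j) if a = 0, and 0 otherwise.
row : ℕ → Code 2
row t = precC (compC oraC (numeral t ∷ projC fzero ∷ [])) zeroC

eval-row : ∀ {m} (x : Fin m → Cantor) t fu a j →
  eval fu (oracle x) (row (toℕ t)) (a ∷ j ∷ []) ≡ just (oracle (λ (_ : Fin 1) → x t) a j)
eval-row x t fu zero j rewrite eval-numeral fu (oracle x) (toℕ t) (j ∷ []) =
  cong (just ∘ bit) (tupleAt-toℕ x t j)
eval-row x t fu (suc a) j = >>=-just⁺ _ (eval-row x t fu a j) refl

computable-row : ∀ {m k} {Φ : (Fin 1 → Cantor) → (Fin k → Cantor)} → Computable Φ →
  (t : Fin m) → Computable (λ x → Φ (λ _ → x t))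
computable-row (e , e-computes) t = replaceOracle (row (toℕ t)) e , λ x i j →
  let fu , e⇓ = e-computes (λ _ → x t) i j
  in fu , trans (eval-replaceOracle (row (toℕ t)) (eval-row x t) fu e (toℕ i ∷ j ∷ [])) e⇓

-- (a , j) ↦ D a (0 , j) for a < n and 0 for a ≥ n, by primitive recursion on a whose
-- step discards the previous value.
select : ∀ {n} → (Fin n → Code 2) → Code 2
select {zero}  D = zeroC
select {suc n} D = precC (compC (D fzero) (zeroC ∷ projC fzero ∷ []))
  (compC (select (D ∘ fsuc)) (projC fzero ∷ projC (fsuc (fsuc fzero)) ∷ []))

select-⇓ : ∀ {n} o (D : Fin n → Code 2) (y : Fin n → Cantor) →
  (∀ t j → o ⊢ D t ∙ (0 ∷ j ∷ []) ⇓ bit (y t j)) →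
  ∀ a j → o ⊢ select D ∙ (a ∷ j ∷ []) ⇓ oracle y a j
select-⇓ {zero}  o D y D⇓ a       j = 0 , refl
select-⇓ {suc n} o D y D⇓ zero    j = D⇓ fzero j
select-⇓ {suc n} o D y D⇓ (suc a) j
  with select-⇓ o D y D⇓ a j | select-⇓ o (D ∘ fsuc) (y ∘ fsuc) (D⇓ ∘ fsuc) a j
... | fu₁ , previous⇓ | fu₂ , tail⇓ = fu₁ ⊔ fu₂ ,
  >>=-just⁺ _ (eval-mono (select D) (a ∷ j ∷ []) (m≤m⊔n fu₁ fu₂) previous⇓)
              (eval-mono (select (D ∘ fsuc)) (a ∷ j ∷ []) (m≤n⊔m fu₁ fu₂) tail⇓)

computable-tabulate : ∀ {m k} {Φ : Fin k → (Fin m → Cantor) → (Fin 1 → Cantor)} →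
  (∀ i → Computable (Φ i)) → Computable (λ x i → Φ i x fzero)
computable-tabulate {Φ = Φ} cΦ = select (proj₁ ∘ cΦ) , λ x i j →
  subst (λ b → oracle x ⊢ select (proj₁ ∘ cΦ) ∙ (toℕ i ∷ j ∷ []) ⇓ bit b)
    (tupleAt-toℕ (λ t → Φ t x fzero) i j)
    (select-⇓ (oracle x) (proj₁ ∘ cΦ) (λ t → Φ t x fzero) (λ t → proj₂ (cΦ t) x fzero) (toℕ i) j)

<lex-irrefl : ∀ {α} → ¬ (α <lex α)
<lex-irrefl (n , _ , αn≡false , αn≡true) with trans (sym αn≡false) αn≡true
... | ()

<lex-open : ∀ {x α} → x <lex α → ∃ λ N → ∀ y → x ≈[ N ] y → y <lex α
<lex-open (n , x≡α , xn , αn) = suc n , λ y x≈y →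
  n , (λ m m<n → trans (sym (x≈y m (m<n⇒m<1+n m<n))) (x≡α m m<n)) ,
  trans (sym (x≈y n (n<1+n n))) xn , αn

truncate : Cantor → ℕ → Cantor
truncate α zero    _       = false
truncate α (suc k) zero    = α zero
truncate α (suc k) (suc m) = truncate (α ∘ suc) k m

truncate-≈ : ∀ α k → α ≈[ k ] truncate α k
truncate-≈ α (suc k) zero    _         = refl
truncate-≈ α (suc k) (suc m) (s≤s m<k) = truncate-≈ (α ∘ suc) k m m<k

truncate-at : ∀ α k → truncate α k k ≡ false
truncate-at α zero    = refl
truncate-at α (suc k) = truncate-at (α ∘ suc) k

proper⇒approximable-from-below : ∀ {α} → Proper α → ∀ N → ∃ λ x → α ≈[ N ] x × x <lex α
proper⇒approximable-from-below {α} proper N with proper N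
... | k , N≤k , αk = truncate α k , ≈-weaken N≤k (truncate-≈ α k) ,
  k , (λ m m<k → sym (truncate-≈ α k m m<k)) , truncate-at α k , αk

S-unique : ∀ {α x b b′} → S α x b → S α x b′ → b ≡ b′
S-unique (inj₁ (refl , _))   (inj₁ (refl , _))   = refl
S-unique (inj₁ (_ , x<α))    (inj₂ (_ , x≮α))    = ⊥-elim (x≮α x<α)
S-unique (inj₂ (_ , x≮α))    (inj₁ (_ , x<α))    = ⊥-elim (x≮α x<α)
S-unique (inj₂ (refl , _))   (inj₂ (refl , _))   = refl

s₁-≤sW-with-identity : ∀ {α β} → Proper α → s₁ α ≤sW s₁ β →
  ∃ λ Φ → Computable Φ × ∀ x b → s₁ β (Φ x) b → s₁ α x b
s₁-≤sW-with-identity {α} {β} proper (Φ , cΦ , Ψ , reduces) =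
  Φ , cΦ , λ x b sβ → subst (s₁ α x) (Ψ-id b) (reduces x b sβ)
  where
  φ : Cantor → Cantor
  φ x = Φ (λ _ → x) fzero

  Ψ-value : ∀ {x b c} → S β (φ x) b → S α x c → Ψ b ≡ c
  Ψ-value {x} sβ sα = S-unique (reduces (λ _ → x) _ sβ) sα

  φα≮β : ¬ (φ α <lex β)
  φα≮β φα<β with <lex-open φα<β
  ... | n , near-φα with computable-uniformly-continuous cΦ (λ _ → α) fzero n
  ... | N , continuous with proper⇒approximable-from-below proper N
  ... | x , α≈x , x<α = not-¬ Ψ0≡0 Ψ0≡1
    where
    Ψ0≡0 : Ψ false ≡ false
    Ψ0≡0 = Ψ-value (inj₁ (refl , near-φα (φ x) (continuous (λ _ → x) (λ _ → α≈x)))) (inj₁ (refl , x<α))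
    Ψ0≡1 : Ψ false ≡ true
    Ψ0≡1 = Ψ-value (inj₁ (refl , φα<β)) (inj₂ (refl , <lex-irrefl))

  Ψ1≡1 : Ψ true ≡ true
  Ψ1≡1 = Ψ-value (inj₂ (refl , φα≮β)) (inj₂ (refl , <lex-irrefl))

  Ψ0≢1 : Ψ false ≢ true
  Ψ0≢1 Ψ0≡1 with proper⇒approximable-from-below proper 0
  ... | x , _ , x<α = not-¬ Ψ1≡1 (Ψ-value (inj₂ (refl , φx≮β)) (inj₁ (refl , x<α)))
    where
    φx≮β : ¬ (φ x <lex β)
    φx≮β φx<β = not-¬ (Ψ-value (inj₁ (refl , φx<β)) (inj₁ (refl , x<α))) Ψ0≡1

  Ψ-id : ∀ b → Ψ b ≡ b
  Ψ-id true  = Ψ1≡1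
  Ψ-id false = ¬-not Ψ0≢1

sF-mono : ∀ {n} (F : (Fin n → Bool) → Bool) {α β : Fin n → Cantor} → (∀ i → Proper (α i)) →
  (∀ i → s₁ (α i) ≤sW s₁ (β i)) → sF F α ≤sW sF F β
sF-mono F {α} {β} proper α≤β =
  Φ , computable-tabulate (λ i → computable-row (proj₁ (proj₂ (reduction i))) i) , (λ b → b) , reduces
  where
  reduction : ∀ i → ∃ λ Φᵢ → Computable Φᵢ × ∀ x b → s₁ (β i) (Φᵢ x) b → s₁ (α i) x b
  reduction i = s₁-≤sW-with-identity (proper i) (α≤β i)

  Φ : (Fin _ → Cantor) → (Fin _ → Cantor)
  Φ x i = proj₁ (reduction i) (λ _ → x i) fzero

  reduces : ∀ x b → sF F β (Φ x) b → sF F α x b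
  reduces x b (bs , sβ , Fbs≡b) = bs , (λ i → proj₂ (proj₂ (reduction i)) (λ _ → x i) (bs i) (sβ i)) , Fbs≡b

mainTheorem12 : (A : Cantor → Set) → (∀ α → A α → Proper α) →
    (∀ α β → A α → A β → s₁ α ≡sW s₁ β) →
    (n : ℕ) (F : (Fin n → Bool) → Bool) →
    (α β : Fin n → Cantor) → (∀ i → A (α i)) → (∀ i → A (β i)) →
    sF F α ≡sW sF F β
mainTheorem12 A proper equivalent n F α β Aα Aβ =
  sF-mono F (λ i → proper _ (Aα i)) (λ i → proj₁ (equivalent _ _ (Aα i) (Aβ i))) ,
  sF-mono F (λ i → proper _ (Aβ i)) (λ i → proj₂ (equivalent _ _ (Aα i) (Aβ i)))
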